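{- For every integer $n\ge 1$, $E_{1,n}=-(n-1)B_n$.
   Context: $B_n$ denote the Bernoulli numbers, $\frac{t}{e^t-1}=\sum_{n\ge0}B_n\frac{t^n}{n!}$. The hypergeometric Euler numbers $E_{1,n}$ are defined by $\dfrac{1}{\sum_{m\ge 0}\frac{2!}{(2+2m)!}t^{2m}}=\sum_{n=0}^\infty E_{1,n}\frac{t^n}{n!}$, i.e. $\sum_n E_{1,n}t^n/n!=\dfrac{t^2/2}{\cosh t-1}$ (this is the case $N=1$ of $1/{}_1F_2(1;N+1,\tfrac{2N+1}{2};\tfrac{t^2}{4})=\sum_n E_{N,n}t^n/n!$). -}

module Defs where

open import Data.Nat as ℕ using (ℕ; zero; suc; _!; _∸_)
open import Data.Nat.Properties using (_!≢0)
open import Data.Nat.Combinatorics using (_C_)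
open import Data.Integer using (+_)
open import Data.Rational using (ℚ; 0ℚ; 1ℚ; _+_; _*_; -_; _/_)
open import Data.Bool using (Bool; true; false; if_then_else_)
open import Data.Fin as Fin using (Fin; toℕ)
open import Data.Vec using (Vec; []; _∷_; _∷ʳ_; lookup; last)

Σ< : (n : ℕ) → (Fin n → ℚ) → ℚ
Σ< zero    f = 0ℚ
Σ< (suc n) f = f Fin.zero + Σ< n (λ k → f (Fin.suc k))

ℕ→ℚ : ℕ → ℚ
ℕ→ℚ n = + n / 1

-- Bernoulli numbers (t/(e^t-1) convention, B_1 = -1/2), via the coefficient
-- identity of (e^t - 1)/t · t/(e^t-1) = 1:
--   Σ_{k=0}^{m} C(m+1,k) B_k = 0  (m ≥ 1),  B_0 = 1.
-- bernVec n = [B_0, …, B_n]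
bernVec : (n : ℕ) → Vec ℚ (suc n)
bernVec zero    = 1ℚ ∷ []
bernVec (suc n) = v ∷ʳ new
  where
  v : Vec ℚ (suc n)
  v = bernVec n
  new : ℚ
  new = - ((+ 1 / suc (suc n)) * Σ< (suc n) (λ k → ℕ→ℚ (suc (suc n) C toℕ k) * lookup v k))

B : ℕ → ℚ
B n = last (bernVec n)

-- Coefficient a_k with  Σ_{m≥0} 2!/(2+2m)! t^{2m} = Σ_k a_k t^k / k!,
-- i.e. a_{2m} = (2m)! · 2! / (2+2m)!,  a_{odd} = 0.
isEven : ℕ → Bool
isEven zero          = true
isEven (suc zero)    = false
isEven (suc (suc k)) = isEven k

a : ℕ → ℚ
a k = if isEven k then _/_ (+ (k ! ℕ.* 2 !)) ((2 ℕ.+ k) !) {{(2 ℕ.+ k) !≢0}} else 0ℚ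

-- Hypergeometric Euler numbers E_{1,n}: the exponential generating function
-- Σ E_{1,n} t^n/n! is the reciprocal of Σ a_k t^k/k!, i.e.
--   Σ_{j=0}^{m} C(m,j) a_{m-j} E_{1,j} = δ_{m,0}   (a_0 = 1).
-- eVec n = [E_{1,0}, …, E_{1,n}]
eVec : (n : ℕ) → Vec ℚ (suc n)
eVec zero    = 1ℚ ∷ []
eVec (suc n) = v ∷ʳ new
  where
  v : Vec ℚ (suc n)
  v = eVec n
  new : ℚ
  new = - Σ< (suc n) (λ j → ℕ→ℚ (suc n C toℕ j) * a (suc n ∸ toℕ j) * lookup v j)

E₁ : ℕ → ℚ
E₁ n = last (eVec n)

-- Work in the ring ℚ⟦t⟧ of formal power series, with β = t/(eᵗ − 1), α = 2(cosh t − 1)/t² and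
-- ε = Σ E₁,ₙ tⁿ/n!. The recurrences defining Bₙ and E₁,ₙ say exactly that (eᵗ − 1)β = t and εα = 1.
-- Applying the derivation θ = t d/dt to the first identity gives (eᵗ − 1)(β − θβ) = t eᵗ β, and
-- t²α = eᵗ + e⁻ᵗ − 2 = e⁻ᵗ(eᵗ − 1)², so t²·α(β − θβ) = e⁻ᵗ(eᵗ − 1)· t eᵗ β = t·(eᵗ − 1)β = t².
-- Cancelling t² gives α(β − θβ) = 1, hence ε = β − θβ, i.e. E₁,ₙ = (1 − n)Bₙ. The identity
-- eᵗe⁻ᵗ = 1 used on the way also comes from θ: θ(eᵗe⁻ᵗ) = 0.

module Submission where

open import Defs
open import Algebra.Bundles using (CommutativeRing)
import Algebra.Construct.Pointwise as Pointwise
open import Algebra.Solver.Ring.AlmostCommutativeRing using (fromCommutativeRing; _-Raw-AlmostCommutative⟶_)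
import Algebra.Solver.Ring as RingSolver
open import Algebra.Structures using (IsAbelianGroup; IsCommutativeRing)
open import Data.Bool using (true; false; if_then_else_)
open import Data.Fin as Fin using (Fin; toℕ; fromℕ; inject₁)
open import Data.Fin.Properties using (toℕ-inject₁; toℕ-fromℕ; toℕ≤pred[n])
open import Data.Fin.Relation.Unary.Top using (View; view; ‵fromℕ; ‵inj₁)
open import Data.Integer as ℤ using (ℤ; +_)
import Data.Integer.Properties as ℤP
import Data.Integer.Solver as ℤSolver
open import Data.Maybe using (Maybe; just; nothing)
open import Data.Nat as ℕ using (ℕ; zero; suc; _!; _∸_; _≤_; NonZero)
open import Data.Nat.Combinatorics using (_C_; nCk≡n!/k![n-k]!; k![n∸k]!∣n!; nCk≡nC[n∸k]; nC1≡n; nCn≡1)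
open import Data.Nat.DivMod using (m/n*n≡m)
open import Data.Nat.Properties using (_!≢0; _!*_!≢0; n∸n≡0; +-∸-assoc; m+[n∸m]≡n; m+n∸n≡m; n≤1+n)
open import Data.Product using (_,_)
open import Data.Rational using (ℚ; 0ℚ; 1ℚ; _+_; _*_; -_; _-_; _/_; toℚᵘ; _≟_; +-*-rawRing)
import Data.Rational.Properties as ℚP
open import Data.Rational.Solver using (module +-*-Solver)
import Data.Rational.Unnormalised as ℚᵘ
import Data.Rational.Unnormalised.Properties as ℚᵘP
open import Data.Vec using (Vec; []; _∷_; lookup; init; last)
open import Data.Vec.Properties using (init-∷ʳ; last-∷ʳ)
open import Function using (_∘_)
open import Level using (0ℓ)
open import Relation.Binary.PropositionalEquality
open import Relation.Nullary using (yes; no)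
open import Algebra.Properties.Semiring.Sum (CommutativeRing.semiring ℚP.+-*-commutativeRing)
  using (sum; sum-syntax; sum⁺-syntax; sum-cong-≗; ∑-distrib-+; *-distribˡ-sum; sum-init-last; sum-replicate-zero)

toℚᵘ-ℕ→ℚ : ∀ n → toℚᵘ (ℕ→ℚ n) ℚᵘ.≃ ℚᵘ.mkℚᵘ (+ n) 0
toℚᵘ-ℕ→ℚ n = ℚP.toℚᵘ-fromℚᵘ (ℚᵘ.mkℚᵘ (+ n) 0)

ℕ→ℚ-+ : ∀ m n → ℕ→ℚ (m ℕ.+ n) ≡ ℕ→ℚ m + ℕ→ℚ n
ℕ→ℚ-+ m n = ℚP.toℚᵘ-injective (begin
  toℚᵘ (ℕ→ℚ (m ℕ.+ n))                 ≈⟨ toℚᵘ-ℕ→ℚ (m ℕ.+ n) ⟩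
  ℚᵘ.mkℚᵘ (+ (m ℕ.+ n)) 0              ≈⟨ ℚᵘ.*≡* (trans (cong (ℤ._* + 1) (ℤP.pos-+ m n))
                                            (solve 2 (λ x y → (x :+ y) :* con (+ 1) := (x :* con (+ 1) :+ y :* con (+ 1)) :* con (+ 1))
                                                   refl (+ m) (+ n))) ⟩
  ℚᵘ.mkℚᵘ (+ m) 0 ℚᵘ.+ ℚᵘ.mkℚᵘ (+ n) 0 ≈⟨ ℚᵘP.+-cong (toℚᵘ-ℕ→ℚ m) (toℚᵘ-ℕ→ℚ n) ⟨
  toℚᵘ (ℕ→ℚ m) ℚᵘ.+ toℚᵘ (ℕ→ℚ n)       ≈⟨ ℚP.toℚᵘ-homo-+ (ℕ→ℚ m) (ℕ→ℚ n) ⟨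
  toℚᵘ (ℕ→ℚ m + ℕ→ℚ n)                 ∎)
  where
  open import Relation.Binary.Reasoning.Setoid ℚᵘP.≃-setoid
  open ℤSolver.+-*-Solver

ℕ→ℚ-* : ∀ m n → ℕ→ℚ (m ℕ.* n) ≡ ℕ→ℚ m * ℕ→ℚ n
ℕ→ℚ-* m n = ℚP.toℚᵘ-injective (begin
  toℚᵘ (ℕ→ℚ (m ℕ.* n))                 ≈⟨ toℚᵘ-ℕ→ℚ (m ℕ.* n) ⟩
  ℚᵘ.mkℚᵘ (+ (m ℕ.* n)) 0              ≈⟨ ℚᵘ.*≡* (cong (ℤ._* + 1) (ℤP.pos-* m n)) ⟩
  ℚᵘ.mkℚᵘ (+ m) 0 ℚᵘ.* ℚᵘ.mkℚᵘ (+ n) 0 ≈⟨ ℚᵘP.*-cong (toℚᵘ-ℕ→ℚ m) (toℚᵘ-ℕ→ℚ n) ⟨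
  toℚᵘ (ℕ→ℚ m) ℚᵘ.* toℚᵘ (ℕ→ℚ n)       ≈⟨ ℚP.toℚᵘ-homo-* (ℕ→ℚ m) (ℕ→ℚ n) ⟨
  toℚᵘ (ℕ→ℚ m * ℕ→ℚ n)                 ∎)
  where open import Relation.Binary.Reasoning.Setoid ℚᵘP.≃-setoid

ℕ→ℚ-*-/ : ∀ n .{{_ : NonZero n}} (i : ℤ) → ℕ→ℚ n * (i / n) ≡ i / 1
ℕ→ℚ-*-/ (suc m) i = ℚP.toℚᵘ-injective (begin
  toℚᵘ (ℕ→ℚ (suc m) * (i / suc m))               ≈⟨ ℚP.toℚᵘ-homo-* (ℕ→ℚ (suc m)) (i / suc m) ⟩
  toℚᵘ (ℕ→ℚ (suc m)) ℚᵘ.* toℚᵘ (i / suc m)       ≈⟨ ℚᵘP.*-cong (toℚᵘ-ℕ→ℚ (suc m)) (ℚP.toℚᵘ-fromℚᵘ (ℚᵘ.mkℚᵘ i m)) ⟩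
  ℚᵘ.mkℚᵘ (+ suc m) 0 ℚᵘ.* ℚᵘ.mkℚᵘ i m           ≈⟨ ℚᵘ.*≡* (solve 2 (λ s j → (s :* j) :* con (+ 1) := j :* (con (+ 1) :* s)) refl (+ suc m) i) ⟩
  ℚᵘ.mkℚᵘ i 0                                    ≈⟨ ℚP.toℚᵘ-fromℚᵘ (ℚᵘ.mkℚᵘ i 0) ⟨
  toℚᵘ (i / 1)                                   ∎)
  where
  open import Relation.Binary.Reasoning.Setoid ℚᵘP.≃-setoid
  open ℤSolver.+-*-Solver

*-cancelˡ-invertible : ∀ {r s x y} → r * s ≡ 1ℚ → s * x ≡ s * y → x ≡ y
*-cancelˡ-invertible {r} {s} {x} {y} rs≡1 sx≡sy = begin
  x            ≡⟨ ℚP.*-identityˡ x ⟨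
  1ℚ * x       ≡⟨ cong (_* x) rs≡1 ⟨
  r * s * x    ≡⟨ ℚP.*-assoc r s x ⟩
  r * (s * x)  ≡⟨ cong (r *_) sx≡sy ⟩
  r * (s * y)  ≡⟨ ℚP.*-assoc r s y ⟨
  r * s * y    ≡⟨ cong (_* y) rs≡1 ⟩
  1ℚ * y       ≡⟨ ℚP.*-identityˡ y ⟩
  y            ∎
  where open ≡-Reasoning

ℕ→ℚ-*-cancelˡ : ∀ n .{{_ : NonZero n}} {x y} → ℕ→ℚ n * x ≡ ℕ→ℚ n * y → x ≡ y
ℕ→ℚ-*-cancelˡ n = *-cancelˡ-invertible {r = + 1 / n} {s = ℕ→ℚ n} (trans (ℚP.*-comm (+ 1 / n) (ℕ→ℚ n)) (ℕ→ℚ-*-/ n (+ 1)))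

1/_! : ℕ → ℚ
1/ n ! = (+ 1 / n !) {{n !≢0}}

!*1/! : ∀ n → ℕ→ℚ (n !) * 1/ n ! ≡ 1ℚ
!*1/! n = ℕ→ℚ-*-/ (n !) {{n !≢0}} (+ 1)

suc*1/! : ∀ n → ℕ→ℚ (suc n) * 1/ suc n ! ≡ 1/ n !
suc*1/! n = ℕ→ℚ-*-cancelˡ (n !) {{n !≢0}} (begin
  ℕ→ℚ (n !) * (ℕ→ℚ (suc n) * 1/ suc n !)   ≡⟨ ℚP.*-assoc (ℕ→ℚ (n !)) _ _ ⟨
  ℕ→ℚ (n !) * ℕ→ℚ (suc n) * 1/ suc n !     ≡⟨ cong (_* 1/ suc n !) (ℚP.*-comm (ℕ→ℚ (n !)) (ℕ→ℚ (suc n))) ⟩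
  ℕ→ℚ (suc n) * ℕ→ℚ (n !) * 1/ suc n !     ≡⟨ cong (_* 1/ suc n !) (ℕ→ℚ-* (suc n) (n !)) ⟨
  ℕ→ℚ (suc n !) * 1/ suc n !               ≡⟨ trans (!*1/! (suc n)) (sym (!*1/! n)) ⟩
  ℕ→ℚ (n !) * 1/ n !                       ∎)
  where open ≡-Reasoning

C*!*!≡! : ∀ {n k} → k ≤ n → (n C k) ℕ.* (k ! ℕ.* (n ∸ k) !) ≡ n !
C*!*!≡! {n} {k} k≤n = trans (cong (ℕ._* (k ! ℕ.* (n ∸ k) !)) (nCk≡n!/k![n-k]! k≤n))
  (m/n*n≡m {{k !* (n ∸ k) !≢0}} (k![n∸k]!∣n! k≤n))

ℕ→ℚ-C : ∀ {n k} → k ≤ n → ℕ→ℚ (n C k) ≡ ℕ→ℚ (n !) * (1/ k ! * 1/ (n ∸ k) !)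
ℕ→ℚ-C {n} {k} k≤n = sym (begin
  ℕ→ℚ (n !) * (1/ k ! * 1/ (n ∸ k) !)
    ≡⟨ cong (_* (1/ k ! * 1/ (n ∸ k) !)) (trans (cong ℕ→ℚ (sym (C*!*!≡! k≤n)))
         (trans (ℕ→ℚ-* (n C k) _) (cong (c *_) (ℕ→ℚ-* (k !) ((n ∸ k) !))))) ⟩
  c * (ℕ→ℚ (k !) * ℕ→ℚ ((n ∸ k) !)) * (1/ k ! * 1/ (n ∸ k) !)
    ≡⟨ solve 5 (λ c a b x y → c :* (a :* b) :* (x :* y) := c :* (a :* x) :* (b :* y)) refl
         c (ℕ→ℚ (k !)) (ℕ→ℚ ((n ∸ k) !)) (1/ k !) (1/ (n ∸ k) !) ⟩
  c * (ℕ→ℚ (k !) * 1/ k !) * (ℕ→ℚ ((n ∸ k) !) * 1/ (n ∸ k) !)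
    ≡⟨ cong₂ (λ x y → c * x * y) (!*1/! k) (!*1/! (n ∸ k)) ⟩
  c * 1ℚ * 1ℚ
    ≡⟨ trans (ℚP.*-identityʳ (c * 1ℚ)) (ℚP.*-identityʳ c) ⟩
  c ∎)
  where
  open ≡-Reasoning
  open +-*-Solver
  c : ℚ
  c = ℕ→ℚ (n C k)

[1+n]C[n]≡1+n : ∀ n → suc n C n ≡ suc n
[1+n]C[n]≡1+n n = trans (nCk≡nC[n∸k] (n≤1+n n)) (trans (cong (suc n C_) (m+n∸n≡m 1 n)) (nC1≡n (suc n)))

Σ<≡sum : ∀ n (f : Fin n → ℚ) → Σ< n f ≡ sum f
Σ<≡sum zero    f = refl
Σ<≡sum (suc n) f = cong (_+_ (f Fin.zero)) (Σ<≡sum n (f ∘ Fin.suc))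

sum-last : ∀ n (f : ℕ → ℚ) → ∑[ k ≤ n ] f (toℕ k) ≡ ∑[ k < n ] f (toℕ k) + f n
sum-last n f = trans (sum-init-last {n} (f ∘ toℕ))
  (cong₂ _+_ (sum-cong-≗ {n} (cong f ∘ toℕ-inject₁)) (cong f (toℕ-fromℕ n)))

module _ {A : Set} where

  lookup-fromℕ : ∀ {n} (xs : Vec A (suc n)) → lookup xs (fromℕ n) ≡ last xs
  lookup-fromℕ (x ∷ [])     = refl
  lookup-fromℕ (x ∷ y ∷ ys) = lookup-fromℕ (y ∷ ys)

  lookup-inject₁ : ∀ {n} (xs : Vec A (suc n)) (k : Fin n) → lookup xs (inject₁ k) ≡ lookup (init xs) k
  lookup-inject₁ (x ∷ y ∷ ys) Fin.zero    = refl
  lookup-inject₁ (x ∷ y ∷ ys) (Fin.suc k) = lookup-inject₁ (y ∷ ys) k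

  module _ (vec : ∀ n → Vec A (suc n)) (init-vec : ∀ n → init (vec (suc n)) ≡ vec n) where

    lookup≡last-prefix : ∀ n (k : Fin (suc n)) → lookup (vec n) k ≡ last (vec (toℕ k))
    lookup≡last-prefix n k = go n (view k)
      where
      go : ∀ n {k : Fin (suc n)} → View k → lookup (vec n) k ≡ last (vec (toℕ k))
      go n       ‵fromℕ = trans (lookup-fromℕ (vec n)) (cong (last ∘ vec) (sym (toℕ-fromℕ n)))
      go (suc n) (‵inj₁ {i = k} v) = begin
        lookup (vec (suc n)) (inject₁ k)   ≡⟨ lookup-inject₁ (vec (suc n)) k ⟩
        lookup (init (vec (suc n))) k      ≡⟨ cong (λ xs → lookup xs k) (init-vec n) ⟩
        lookup (vec n) k                   ≡⟨ go n v ⟩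
        last (vec (toℕ k))                 ≡⟨ cong (last ∘ vec) (toℕ-inject₁ k) ⟨
        last (vec (toℕ (inject₁ k)))       ∎
        where open ≡-Reasoning

lookup-bernVec : ∀ n (k : Fin (suc n)) → lookup (bernVec n) k ≡ B (toℕ k)
lookup-bernVec = lookup≡last-prefix bernVec (λ n → init-∷ʳ _ (bernVec n))

lookup-eVec : ∀ n (k : Fin (suc n)) → lookup (eVec n) k ≡ E₁ (toℕ k)
lookup-eVec = lookup≡last-prefix eVec (λ n → init-∷ʳ _ (eVec n))

bernoulli-recurrence : ∀ n → ∑[ k ≤ suc n ] (ℕ→ℚ (suc (suc n) C toℕ k) * B (toℕ k)) ≡ 0ℚ
bernoulli-recurrence n = begin
  ∑[ k ≤ suc n ] (ℕ→ℚ (N C toℕ k) * B (toℕ k))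
    ≡⟨ sum-last (suc n) (λ k → ℕ→ℚ (N C k) * B k) ⟩
  T + ℕ→ℚ (N C suc n) * B (suc n)
    ≡⟨ cong₂ (λ m b → T + ℕ→ℚ m * b) ([1+n]C[n]≡1+n (suc n)) (last-∷ʳ _ (bernVec n)) ⟩
  T + ℕ→ℚ N * - ((+ 1 / N) * Σ< (suc n) (λ k → ℕ→ℚ (N C toℕ k) * lookup (bernVec n) k))
    ≡⟨ cong (λ t → T + ℕ→ℚ N * - ((+ 1 / N) * t)) (trans (Σ<≡sum (suc n) (λ k → ℕ→ℚ (N C toℕ k) * lookup (bernVec n) k))
         (sum-cong-≗ {suc n} (λ k → cong (ℕ→ℚ (N C toℕ k) *_) (lookup-bernVec n k)))) ⟩
  T + ℕ→ℚ N * - ((+ 1 / N) * T)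
    ≡⟨ solve 3 (λ t m d → t :+ m :* (:- (d :* t)) := t :- (m :* d) :* t) refl T (ℕ→ℚ N) (+ 1 / N) ⟩
  T - ℕ→ℚ N * (+ 1 / N) * T
    ≡⟨ cong (λ x → T - x * T) (ℕ→ℚ-*-/ N (+ 1)) ⟩
  T - 1ℚ * T
    ≡⟨ solve 1 (λ t → t :- con 1ℚ :* t := con 0ℚ) refl T ⟩
  0ℚ ∎
  where
  open ≡-Reasoning
  open +-*-Solver
  N : ℕ
  N = suc (suc n)
  T : ℚ
  T = ∑[ k ≤ n ] (ℕ→ℚ (N C toℕ k) * B (toℕ k))

euler-recurrence : ∀ n → ∑[ k ≤ suc n ] (ℕ→ℚ (suc n C toℕ k) * E₁ (toℕ k) * a (suc n ∸ toℕ k)) ≡ 0ℚ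
euler-recurrence n = begin
  ∑[ k ≤ suc n ] (ℕ→ℚ (N C toℕ k) * E₁ (toℕ k) * a (N ∸ toℕ k))
    ≡⟨ sum-last (suc n) (λ k → ℕ→ℚ (N C k) * E₁ k * a (N ∸ k)) ⟩
  T + ℕ→ℚ (N C N) * E₁ N * a (N ∸ N)
    ≡⟨ cong₂ (λ m k → T + ℕ→ℚ m * E₁ N * a k) (nCn≡1 N) (n∸n≡0 N) ⟩
  T + 1ℚ * E₁ N * 1ℚ
    ≡⟨ cong (λ e → T + 1ℚ * e * 1ℚ) (last-∷ʳ _ (eVec n)) ⟩
  T + 1ℚ * - Σ< N (λ j → ℕ→ℚ (N C toℕ j) * a (N ∸ toℕ j) * lookup (eVec n) j) * 1ℚ
    ≡⟨ cong (λ t → T + 1ℚ * - t * 1ℚ)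
         (trans (Σ<≡sum N (λ j → ℕ→ℚ (N C toℕ j) * a (N ∸ toℕ j) * lookup (eVec n) j)) (sum-cong-≗ {N} reorder)) ⟩
  T + 1ℚ * - T * 1ℚ
    ≡⟨ solve 1 (λ t → t :+ con 1ℚ :* (:- t) :* con 1ℚ := con 0ℚ) refl T ⟩
  0ℚ ∎
  where
  open ≡-Reasoning
  open +-*-Solver
  N : ℕ
  N = suc n
  T : ℚ
  T = ∑[ k ≤ n ] (ℕ→ℚ (N C toℕ k) * E₁ (toℕ k) * a (N ∸ toℕ k))
  reorder : ∀ k → ℕ→ℚ (N C toℕ k) * a (N ∸ toℕ k) * lookup (eVec n) k ≡ ℕ→ℚ (N C toℕ k) * E₁ (toℕ k) * a (N ∸ toℕ k)
  reorder k = trans (cong (ℕ→ℚ (N C toℕ k) * a (N ∸ toℕ k) *_) (lookup-eVec n k))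
    (solve 3 (λ c x y → c :* y :* x := c :* x :* y) refl (ℕ→ℚ (N C toℕ k)) (E₁ (toℕ k)) (a (N ∸ toℕ k)))

-- The ring ℚ⟦t⟧ of formal power series

Series : Set
Series = ℕ → ℚ

infixl 7 _⊛_ _·_
infixl 6 _⊕_
infix  8 ⊖_

_⊕_ : Series → Series → Series
(f ⊕ g) n = f n + g n

⊖_ : Series → Series
(⊖ f) n = - f n

_·_ : ℚ → Series → Series
(q · f) n = q * f n

_⊛_ : Series → Series → Series
(f ⊛ g) n = ∑[ k ≤ n ] (f (toℕ k) * g (n ∸ toℕ k))

κ : ℚ → Series
κ q zero    = q
κ q (suc n) = 0ℚ

𝟘 : Series
𝟘 _ = 0ℚ

𝟙 : Series
𝟙 = κ 1ℚ

X : Series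
X zero    = 0ℚ
X (suc n) = 𝟙 n

shift : Series → Series
shift f = f ∘ suc

⊛-cong : ∀ {f f′ g g′} → f ≗ f′ → g ≗ g′ → f ⊛ g ≗ f′ ⊛ g′
⊛-cong f≗f′ g≗g′ n = sum-cong-≗ {suc n} (λ k → cong₂ _*_ (f≗f′ (toℕ k)) (g≗g′ (n ∸ toℕ k)))

⊛-distribʳ : ∀ h f g → (f ⊕ g) ⊛ h ≗ f ⊛ h ⊕ g ⊛ h
⊛-distribʳ h f g n = trans (sum-cong-≗ {suc n} (λ k → ℚP.*-distribʳ-+ (h (n ∸ toℕ k)) (f (toℕ k)) (g (toℕ k))))
  (∑-distrib-+ {suc n} (λ k → f (toℕ k) * h (n ∸ toℕ k)) (λ k → g (toℕ k) * h (n ∸ toℕ k)))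

·-⊛ : ∀ q f g → (q · f) ⊛ g ≗ q · (f ⊛ g)
·-⊛ q f g n = trans (sum-cong-≗ {suc n} (λ k → ℚP.*-assoc q (f (toℕ k)) (g (n ∸ toℕ k))))
  (sym (*-distribˡ-sum {suc n} q (λ k → f (toℕ k) * g (n ∸ toℕ k))))

⊛-assoc : ∀ f g h → (f ⊛ g) ⊛ h ≗ f ⊛ (g ⊛ h)
⊛-assoc f g h zero = solve 3 (λ a b c → (a :* b :+ con 0ℚ) :* c :+ con 0ℚ := a :* (b :* c :+ con 0ℚ) :+ con 0ℚ) refl (f 0) (g 0) (h 0)
  where open +-*-Solver
-- shift (f ⊛ g) is definitionally f 0 · shift g ⊕ shift f ⊛ g.
⊛-assoc f g h (suc n) = begin
  (f 0 * g 0 + 0ℚ) * h (suc n) + (shift (f ⊛ g) ⊛ h) n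
    ≡⟨ cong (_+_ ((f 0 * g 0 + 0ℚ) * h (suc n))) (⊛-distribʳ h (f 0 · shift g) (shift f ⊛ g) n) ⟩
  (f 0 * g 0 + 0ℚ) * h (suc n) + (((f 0 · shift g) ⊛ h) n + ((shift f ⊛ g) ⊛ h) n)
    ≡⟨ cong₂ (λ x y → (f 0 * g 0 + 0ℚ) * h (suc n) + (x + y)) (·-⊛ (f 0) (shift g) h n) (⊛-assoc (shift f) g h n) ⟩
  (f 0 * g 0 + 0ℚ) * h (suc n) + (f 0 * (shift g ⊛ h) n + (shift f ⊛ (g ⊛ h)) n)
    ≡⟨ solve 5 (λ a b c d e → (a :* b :+ con 0ℚ) :* c :+ (a :* d :+ e) := a :* (b :* c :+ d) :+ e) refl
         (f 0) (g 0) (h (suc n)) ((shift g ⊛ h) n) ((shift f ⊛ (g ⊛ h)) n) ⟩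
  f 0 * (g ⊛ h) (suc n) + (shift f ⊛ (g ⊛ h)) n ∎
  where
  open ≡-Reasoning
  open +-*-Solver

κ-⊛ : ∀ q f → κ q ⊛ f ≗ q · f
κ-⊛ q f zero    = ℚP.+-identityʳ (q * f 0)
κ-⊛ q f (suc n) = begin
  q * f (suc n) + (𝟘 ⊛ f) n  ≡⟨ cong (_+_ (q * f (suc n))) 𝟘⊛f≡0 ⟩
  q * f (suc n) + 0ℚ        ≡⟨ ℚP.+-identityʳ (q * f (suc n)) ⟩
  q * f (suc n)             ∎
  where
  open ≡-Reasoning
  𝟘⊛f≡0 : (𝟘 ⊛ f) n ≡ 0ℚ
  𝟘⊛f≡0 = trans (sum-cong-≗ {suc n} (λ k → ℚP.*-zeroˡ (f (n ∸ toℕ k)))) (sum-replicate-zero (suc n))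

⊛-identityˡ : ∀ f → 𝟙 ⊛ f ≗ f
⊛-identityˡ f n = trans (κ-⊛ 1ℚ f n) (ℚP.*-identityˡ (f n))

⊛-last : ∀ f g n → (f ⊛ g) (suc n) ≡ (f ⊛ shift g) n + f (suc n) * g 0
⊛-last f g n = trans (sum-last (suc n) (λ k → f k * g (suc n ∸ k))) (cong₂ _+_
  (sum-cong-≗ {suc n} (λ k → cong (λ m → f (toℕ k) * g m) (+-∸-assoc 1 (toℕ≤pred[n] k))))
  (cong (λ m → f (suc n) * g m) (n∸n≡0 (suc n))))

⊛-comm : ∀ f g → f ⊛ g ≗ g ⊛ f
⊛-comm f g zero    = cong (λ x → x + 0ℚ) (ℚP.*-comm (f 0) (g 0))
⊛-comm f g (suc n) = begin
  f 0 * g (suc n) + (shift f ⊛ g) n   ≡⟨ cong (_+_ (f 0 * g (suc n))) (⊛-comm (shift f) g n) ⟩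
  f 0 * g (suc n) + (g ⊛ shift f) n   ≡⟨ ℚP.+-comm (f 0 * g (suc n)) _ ⟩
  (g ⊛ shift f) n + f 0 * g (suc n)   ≡⟨ cong (_+_ ((g ⊛ shift f) n)) (ℚP.*-comm (f 0) (g (suc n))) ⟩
  (g ⊛ shift f) n + g (suc n) * f 0   ≡⟨ ⊛-last g f n ⟨
  (g ⊛ f) (suc n)                     ∎
  where open ≡-Reasoning

⊛-identityʳ : ∀ f → f ⊛ 𝟙 ≗ f
⊛-identityʳ f n = trans (⊛-comm f 𝟙 n) (⊛-identityˡ f n)

⊛-distribˡ : ∀ f g h → f ⊛ (g ⊕ h) ≗ f ⊛ g ⊕ f ⊛ h
⊛-distribˡ f g h n = begin
  (f ⊛ (g ⊕ h)) n            ≡⟨ ⊛-comm f (g ⊕ h) n ⟩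
  ((g ⊕ h) ⊛ f) n            ≡⟨ ⊛-distribʳ f g h n ⟩
  (g ⊛ f) n + (h ⊛ f) n      ≡⟨ cong₂ _+_ (⊛-comm g f n) (⊛-comm h f n) ⟩
  (f ⊛ g) n + (f ⊛ h) n      ∎
  where open ≡-Reasoning

⊕-isAbelianGroup : IsAbelianGroup _≗_ _⊕_ 𝟘 ⊖_
⊕-isAbelianGroup = Pointwise.isAbelianGroup ℕ ℚP.+-0-isAbelianGroup

⊕-⊛-isCommutativeRing : IsCommutativeRing _≗_ _⊕_ _⊛_ ⊖_ 𝟘 𝟙
⊕-⊛-isCommutativeRing = record
  { isRing = record
    { +-isAbelianGroup = ⊕-isAbelianGroup
    ; *-cong           = ⊛-cong
    ; *-assoc          = ⊛-assoc
    ; *-identity       = ⊛-identityˡ , ⊛-identityʳ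
    ; distrib          = ⊛-distribˡ , ⊛-distribʳ
    }
  ; *-comm = ⊛-comm
  }

ℚ⟦t⟧ : CommutativeRing 0ℓ 0ℓ
ℚ⟦t⟧ = record { isCommutativeRing = ⊕-⊛-isCommutativeRing }

κ-homomorphism : +-*-rawRing -Raw-AlmostCommutative⟶ fromCommutativeRing ℚ⟦t⟧
κ-homomorphism = record
  { ⟦_⟧    = κ
  ; +-homo = λ { p q zero → refl ; p q (suc n) → refl }
  ; *-homo = λ { p q zero → sym (κ-⊛ p (κ q) 0) ; p q (suc n) → sym (trans (κ-⊛ p (κ q) (suc n)) (ℚP.*-zeroʳ p)) }
  ; -‿homo = λ { p zero → refl ; p (suc n) → refl }
  ; 0-homo = λ { zero → refl ; (suc n) → refl }
  ; 1-homo = λ _ → refl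
  }

κ-≟ : ∀ p q → Maybe (κ p ≗ κ q)
κ-≟ p q with p ≟ q
... | yes refl = just (λ _ → refl)
... | no _     = nothing

-- Coefficients are taken in ℚ, whose decidable equality makes the solver's normal forms canonical.
module ℚ⟦t⟧-Solver = RingSolver +-*-rawRing (fromCommutativeRing ℚ⟦t⟧) κ-homomorphism κ-≟

X-⊛-zero : ∀ f → (X ⊛ f) 0 ≡ 0ℚ
X-⊛-zero f = trans (ℚP.+-identityʳ (0ℚ * f 0)) (ℚP.*-zeroˡ (f 0))

shift-X-⊛ : ∀ f → shift (X ⊛ f) ≗ f
shift-X-⊛ f n = trans (cong₂ _+_ (ℚP.*-zeroˡ (f (suc n))) (⊛-identityˡ f n)) (ℚP.+-identityˡ (f n))

X-⊛-cancelˡ : ∀ {f g} → X ⊛ f ≗ X ⊛ g → f ≗ g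
X-⊛-cancelˡ {f} {g} Xf≗Xg n = trans (sym (shift-X-⊛ f n)) (trans (Xf≗Xg (suc n)) (shift-X-⊛ g n))

-- The Euler operator θ = t d/dt and exponential generating functions

θ : Series → Series
θ f n = ℕ→ℚ n * f n

θ-⊕ : ∀ f g → θ (f ⊕ g) ≗ θ f ⊕ θ g
θ-⊕ f g n = ℚP.*-distribˡ-+ (ℕ→ℚ n) (f n) (g n)

θ-⊛ : ∀ f g → θ (f ⊛ g) ≗ θ f ⊛ g ⊕ f ⊛ θ g
θ-⊛ f g n = begin
  ℕ→ℚ n * ∑[ k ≤ n ] (f (toℕ k) * g (n ∸ toℕ k))
    ≡⟨ *-distribˡ-sum {suc n} (ℕ→ℚ n) (λ k → f (toℕ k) * g (n ∸ toℕ k)) ⟩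
  ∑[ k ≤ n ] (ℕ→ℚ n * (f (toℕ k) * g (n ∸ toℕ k)))
    ≡⟨ sum-cong-≗ {suc n} (λ k → split (toℕ≤pred[n] k)) ⟩
  ∑[ k ≤ n ] (θ f (toℕ k) * g (n ∸ toℕ k) + f (toℕ k) * θ g (n ∸ toℕ k))
    ≡⟨ ∑-distrib-+ {suc n} (λ k → θ f (toℕ k) * g (n ∸ toℕ k)) (λ k → f (toℕ k) * θ g (n ∸ toℕ k)) ⟩
  (θ f ⊛ g) n + (f ⊛ θ g) n ∎
  where
  open ≡-Reasoning
  split : ∀ {k} → k ≤ n → ℕ→ℚ n * (f k * g (n ∸ k)) ≡ θ f k * g (n ∸ k) + f k * θ g (n ∸ k)
  split {k} k≤n = begin
    ℕ→ℚ n * (f k * g (n ∸ k))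
      ≡⟨ cong (λ m → ℕ→ℚ m * (f k * g (n ∸ k))) (m+[n∸m]≡n k≤n) ⟨
    ℕ→ℚ (k ℕ.+ (n ∸ k)) * (f k * g (n ∸ k))
      ≡⟨ cong (_* (f k * g (n ∸ k))) (ℕ→ℚ-+ k (n ∸ k)) ⟩
    (ℕ→ℚ k + ℕ→ℚ (n ∸ k)) * (f k * g (n ∸ k))
      ≡⟨ solve 4 (λ a b x y → (a :+ b) :* (x :* y) := a :* x :* y :+ x :* (b :* y)) refl
           (ℕ→ℚ k) (ℕ→ℚ (n ∸ k)) (f k) (g (n ∸ k)) ⟩
    θ f k * g (n ∸ k) + f k * θ g (n ∸ k) ∎
    where open +-*-Solver

θ-X : θ X ≗ X
θ-X zero          = refl
θ-X (suc zero)    = refl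
θ-X (suc (suc n)) = ℚP.*-zeroʳ (ℕ→ℚ (suc (suc n)))

θ-kernel : ∀ {f} → θ f ≗ 𝟘 → f ≗ κ (f 0)
θ-kernel θf≗0 zero    = refl
θ-kernel θf≗0 (suc n) = ℕ→ℚ-*-cancelˡ (suc n) (trans (θf≗0 (suc n)) (sym (ℚP.*-zeroʳ (ℕ→ℚ (suc n)))))

θ-cong : ∀ {f g} → f ≗ g → θ f ≗ θ g
θ-cong f≗g n = cong (ℕ→ℚ n *_) (f≗g n)

egf : (ℕ → ℚ) → Series
egf c n = c n * 1/ n !

!*egf : ∀ c n → ℕ→ℚ (n !) * egf c n ≡ c n
!*egf c n = begin
  ℕ→ℚ (n !) * (c n * 1/ n !)   ≡⟨ cong (ℕ→ℚ (n !) *_) (ℚP.*-comm (c n) (1/ n !)) ⟩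
  ℕ→ℚ (n !) * (1/ n ! * c n)   ≡⟨ ℚP.*-assoc (ℕ→ℚ (n !)) (1/ n !) (c n) ⟨
  ℕ→ℚ (n !) * 1/ n ! * c n     ≡⟨ cong (_* c n) (!*1/! n) ⟩
  1ℚ * c n                     ≡⟨ ℚP.*-identityˡ (c n) ⟩
  c n                          ∎
  where open ≡-Reasoning

egf-injective : ∀ {c d} → egf c ≗ egf d → c ≗ d
egf-injective {c} {d} egfc≗egfd n = trans (sym (!*egf c n)) (trans (cong (ℕ→ℚ (n !) *_) (egfc≗egfd n)) (!*egf d n))

egf-⊛ : ∀ c d n → ℕ→ℚ (n !) * (egf c ⊛ egf d) n ≡ ∑[ k ≤ n ] (ℕ→ℚ (n C toℕ k) * c (toℕ k) * d (n ∸ toℕ k))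
egf-⊛ c d n = trans (*-distribˡ-sum {suc n} (ℕ→ℚ (n !)) (λ k → egf c (toℕ k) * egf d (n ∸ toℕ k)))
  (sum-cong-≗ {suc n} (λ k → binomial (toℕ≤pred[n] k)))
  where
  binomial : ∀ {k} → k ≤ n → ℕ→ℚ (n !) * (egf c k * egf d (n ∸ k)) ≡ ℕ→ℚ (n C k) * c k * d (n ∸ k)
  binomial {k} k≤n = begin
    ℕ→ℚ (n !) * (c k * 1/ k ! * (d (n ∸ k) * 1/ (n ∸ k) !))
      ≡⟨ solve 5 (λ F x u y v → F :* (x :* u :* (y :* v)) := F :* (u :* v) :* x :* y) refl
           (ℕ→ℚ (n !)) (c k) (1/ k !) (d (n ∸ k)) (1/ (n ∸ k) !) ⟩
    ℕ→ℚ (n !) * (1/ k ! * 1/ (n ∸ k) !) * c k * d (n ∸ k)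
      ≡⟨ cong (λ x → x * c k * d (n ∸ k)) (ℕ→ℚ-C k≤n) ⟨
    ℕ→ℚ (n C k) * c k * d (n ∸ k) ∎
    where
    open ≡-Reasoning
    open +-*-Solver

θ-egf : ∀ c → θ (egf c) ≗ X ⊛ egf (c ∘ suc)
θ-egf c zero    = trans (ℚP.*-zeroˡ (egf c 0)) (sym (X-⊛-zero (egf (c ∘ suc))))
θ-egf c (suc n) = begin
  ℕ→ℚ (suc n) * (c (suc n) * 1/ suc n !)   ≡⟨ solve 3 (λ m x u → m :* (x :* u) := x :* (m :* u)) refl (ℕ→ℚ (suc n)) (c (suc n)) (1/ suc n !) ⟩
  c (suc n) * (ℕ→ℚ (suc n) * 1/ suc n !)   ≡⟨ cong (c (suc n) *_) (suc*1/! n) ⟩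
  egf (c ∘ suc) n                          ≡⟨ shift-X-⊛ (egf (c ∘ suc)) n ⟨
  (X ⊛ egf (c ∘ suc)) (suc n)              ∎
  where
  open ≡-Reasoning
  open +-*-Solver

-- The series eᵗ, e⁻ᵗ, t/(eᵗ − 1), 2(cosh t − 1)/t² and Σ E₁,ₙ tⁿ/n!

alt : ℕ → ℚ
alt zero    = 1ℚ
alt (suc n) = - alt n

alt-isEven : ∀ n → alt n ≡ (if isEven n then 1ℚ else - 1ℚ)
alt-isEven zero          = refl
alt-isEven (suc zero)    = refl
alt-isEven (suc (suc n)) = trans (solve 1 (λ x → :- :- x := x) refl (alt n)) (alt-isEven n)
  where open +-*-Solver

eᵗ e⁻ᵗ β α ε : Series
eᵗ  = egf (λ _ → 1ℚ)
e⁻ᵗ = egf alt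
β   = egf B
α   = egf a
ε   = egf E₁

β⊛eᵗ≗β+X : β ⊛ eᵗ ≗ β ⊕ X
β⊛eᵗ≗β+X zero          = refl
β⊛eᵗ≗β+X (suc zero)    = refl
β⊛eᵗ≗β+X (suc (suc n)) = ℕ→ℚ-*-cancelˡ (N !) {{N !≢0}} (begin
  ℕ→ℚ (N !) * (β ⊛ eᵗ) N
    ≡⟨ egf-⊛ B (λ _ → 1ℚ) N ⟩
  ∑[ k ≤ N ] (ℕ→ℚ (N C toℕ k) * B (toℕ k) * 1ℚ)
    ≡⟨ sum-last N (λ k → ℕ→ℚ (N C k) * B k * 1ℚ) ⟩
  ∑[ k ≤ suc n ] (ℕ→ℚ (N C toℕ k) * B (toℕ k) * 1ℚ) + ℕ→ℚ (N C N) * B N * 1ℚ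
    ≡⟨ cong₂ (λ s m → s + ℕ→ℚ m * B N * 1ℚ)
         (trans (sum-cong-≗ {N} (λ k → ℚP.*-identityʳ (ℕ→ℚ (N C toℕ k) * B (toℕ k)))) (bernoulli-recurrence n)) (nCn≡1 N) ⟩
  0ℚ + 1ℚ * B N * 1ℚ
    ≡⟨ solve 1 (λ b → con 0ℚ :+ con 1ℚ :* b :* con 1ℚ := b) refl (B N) ⟩
  B N
    ≡⟨ !*egf B N ⟨
  ℕ→ℚ (N !) * β N
    ≡⟨ cong (ℕ→ℚ (N !) *_) (ℚP.+-identityʳ (β N)) ⟨
  ℕ→ℚ (N !) * (β ⊕ X) N ∎)
  where
  open ≡-Reasoning
  open +-*-Solver
  N : ℕ
  N = suc (suc n)

ε⊛α≗𝟙 : ε ⊛ α ≗ 𝟙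
ε⊛α≗𝟙 zero    = refl
ε⊛α≗𝟙 (suc n) = ℕ→ℚ-*-cancelˡ (suc n !) {{suc n !≢0}} (begin
  ℕ→ℚ (suc n !) * (ε ⊛ α) (suc n)   ≡⟨ egf-⊛ E₁ a (suc n) ⟩
  ∑[ k ≤ suc n ] (ℕ→ℚ (suc n C toℕ k) * E₁ (toℕ k) * a (suc n ∸ toℕ k))
                                    ≡⟨ euler-recurrence n ⟩
  0ℚ                                ≡⟨ ℚP.*-zeroʳ (ℕ→ℚ (suc n !)) ⟨
  ℕ→ℚ (suc n !) * 𝟙 (suc n)         ∎)
  where open ≡-Reasoning

α≡eᵗ+e⁻ᵗ : ∀ n → α n ≡ eᵗ (2 ℕ.+ n) + e⁻ᵗ (2 ℕ.+ n)
α≡eᵗ+e⁻ᵗ n with isEven n | alt-isEven n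
... | true  | alt≡1  = ℕ→ℚ-*-cancelˡ (N !) {{N !≢0}} (begin
  F * ((+ (n ! ℕ.* 2) / N !) {{N !≢0}} * 1/ n !)   ≡⟨ ℚP.*-assoc F _ (1/ n !) ⟨
  F * (+ (n ! ℕ.* 2) / N !) {{N !≢0}} * 1/ n !     ≡⟨ cong (_* 1/ n !) (ℕ→ℚ-*-/ (N !) {{N !≢0}} (+ (n ! ℕ.* 2))) ⟩
  ℕ→ℚ (n ! ℕ.* 2) * 1/ n !                         ≡⟨ cong (_* 1/ n !) (ℕ→ℚ-* (n !) 2) ⟩
  ℕ→ℚ (n !) * ℕ→ℚ 2 * 1/ n !                       ≡⟨ solve 3 (λ f t v → f :* t :* v := f :* v :* t) refl (ℕ→ℚ (n !)) (ℕ→ℚ 2) (1/ n !) ⟩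
  ℕ→ℚ (n !) * 1/ n ! * ℕ→ℚ 2                       ≡⟨ cong (_* ℕ→ℚ 2) (trans (!*1/! n) (sym (!*1/! N))) ⟩
  F * 1/ N ! * (1ℚ + 1ℚ)                           ≡⟨ solve 2 (λ f u → f :* u :* (con 1ℚ :+ con 1ℚ) := f :* (con 1ℚ :* u :+ :- :- con 1ℚ :* u)) refl F (1/ N !) ⟩
  F * (1ℚ * 1/ N ! + - - 1ℚ * 1/ N !)              ≡⟨ cong (λ s → F * (1ℚ * 1/ N ! + - - s * 1/ N !)) alt≡1 ⟨
  F * (eᵗ N + e⁻ᵗ N)                               ∎)
  where
  open ≡-Reasoning
  open +-*-Solver
  N : ℕ
  N = 2 ℕ.+ n
  F : ℚ
  F = ℕ→ℚ (N !)
... | false | alt≡-1 = begin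
  0ℚ * 1/ n !                                      ≡⟨ ℚP.*-zeroˡ (1/ n !) ⟩
  0ℚ                                               ≡⟨ solve 1 (λ u → con 0ℚ := con 1ℚ :* u :+ :- :- con (- 1ℚ) :* u) refl (1/ suc (suc n) !) ⟩
  1ℚ * 1/ suc (suc n) ! + - - (- 1ℚ) * 1/ suc (suc n) !  ≡⟨ cong (λ s → 1ℚ * 1/ suc (suc n) ! + - - s * 1/ suc (suc n) !) alt≡-1 ⟨
  eᵗ (2 ℕ.+ n) + e⁻ᵗ (2 ℕ.+ n)                     ∎
  where
  open ≡-Reasoning
  open +-*-Solver

X⊛[X⊛α]+2≗eᵗ+e⁻ᵗ : X ⊛ (X ⊛ α) ⊕ (𝟙 ⊕ 𝟙) ≗ eᵗ ⊕ e⁻ᵗ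
X⊛[X⊛α]+2≗eᵗ+e⁻ᵗ zero          = refl
X⊛[X⊛α]+2≗eᵗ+e⁻ᵗ (suc zero)    = refl
X⊛[X⊛α]+2≗eᵗ+e⁻ᵗ (suc (suc n)) = begin
  (X ⊛ (X ⊛ α)) (2 ℕ.+ n) + 0ℚ     ≡⟨ ℚP.+-identityʳ _ ⟩
  (X ⊛ (X ⊛ α)) (2 ℕ.+ n)          ≡⟨ shift-X-⊛ (X ⊛ α) (suc n) ⟩
  (X ⊛ α) (suc n)                  ≡⟨ shift-X-⊛ α n ⟩
  α n                              ≡⟨ α≡eᵗ+e⁻ᵗ n ⟩
  eᵗ (2 ℕ.+ n) + e⁻ᵗ (2 ℕ.+ n)     ∎
  where open ≡-Reasoning

θ-eᵗ : θ eᵗ ≗ X ⊛ eᵗ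
θ-eᵗ = θ-egf (λ _ → 1ℚ)

θ-e⁻ᵗ : θ e⁻ᵗ ≗ X ⊛ ⊖ e⁻ᵗ
θ-e⁻ᵗ n = trans (θ-egf alt n) (⊛-cong {X} (λ _ → refl) (λ k → sym (ℚP.neg-distribˡ-* (alt k) (1/ k !))) n)

module _ where
  open CommutativeRing ℚ⟦t⟧ using (+-cong; +-congˡ; +-congʳ; -‿cong; *-cong; *-congˡ; *-congʳ)
  open import Relation.Binary.Reasoning.Setoid (CommutativeRing.setoid ℚ⟦t⟧)
  open ℚ⟦t⟧-Solver

  eᵗ⊛e⁻ᵗ≗𝟙 : eᵗ ⊛ e⁻ᵗ ≗ 𝟙
  eᵗ⊛e⁻ᵗ≗𝟙 = θ-kernel (begin
    θ (eᵗ ⊛ e⁻ᵗ)                                 ≈⟨ θ-⊛ eᵗ e⁻ᵗ ⟩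
    θ eᵗ ⊛ e⁻ᵗ ⊕ eᵗ ⊛ θ e⁻ᵗ                      ≈⟨ +-cong (*-congʳ {e⁻ᵗ} θ-eᵗ) (*-congˡ {eᵗ} θ-e⁻ᵗ) ⟩
    X ⊛ eᵗ ⊛ e⁻ᵗ ⊕ eᵗ ⊛ (X ⊛ ⊖ e⁻ᵗ)              ≈⟨ solve 3 (λ e ē x → x :* e :* ē :+ e :* (x :* :- ē) := con 0ℚ) (λ _ → refl) eᵗ e⁻ᵗ X ⟩
    κ 0ℚ                                         ≈⟨ _-Raw-AlmostCommutative⟶_.0-homo κ-homomorphism ⟩
    𝟘                                            ∎)

  θβ⊛eᵗ+β⊛[X⊛eᵗ]≗θβ+X : θ β ⊛ eᵗ ⊕ β ⊛ (X ⊛ eᵗ) ≗ θ β ⊕ X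
  θβ⊛eᵗ+β⊛[X⊛eᵗ]≗θβ+X = begin
    θ β ⊛ eᵗ ⊕ β ⊛ (X ⊛ eᵗ)   ≈⟨ +-congˡ {θ β ⊛ eᵗ} (*-congˡ {β} θ-eᵗ) ⟨
    θ β ⊛ eᵗ ⊕ β ⊛ θ eᵗ      ≈⟨ θ-⊛ β eᵗ ⟨
    θ (β ⊛ eᵗ)               ≈⟨ θ-cong β⊛eᵗ≗β+X ⟩
    θ (β ⊕ X)                ≈⟨ θ-⊕ β X ⟩
    θ β ⊕ θ X                ≈⟨ +-congˡ {θ β} θ-X ⟩
    θ β ⊕ X                  ∎

  [eᵗ-1]⊛β≗X : (eᵗ ⊕ ⊖ 𝟙) ⊛ β ≗ X
  [eᵗ-1]⊛β≗X = begin
    (eᵗ ⊕ ⊖ 𝟙) ⊛ β           ≈⟨ solve 2 (λ e b → (e :- con 1ℚ) :* b := b :* e :- b) (λ _ → refl) eᵗ β ⟩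
    β ⊛ eᵗ ⊕ ⊖ β             ≈⟨ +-congʳ β⊛eᵗ≗β+X ⟩
    β ⊕ X ⊕ ⊖ β              ≈⟨ solve 2 (λ b x → b :+ x :- b := x) (λ _ → refl) β X ⟩
    X                        ∎

  [eᵗ-1]⊛[β-θβ]≗X⊛eᵗ⊛β : (eᵗ ⊕ ⊖ 𝟙) ⊛ (β ⊕ ⊖ θ β) ≗ X ⊛ eᵗ ⊛ β
  [eᵗ-1]⊛[β-θβ]≗X⊛eᵗ⊛β = begin
    (eᵗ ⊕ ⊖ 𝟙) ⊛ (β ⊕ ⊖ θ β)
      ≈⟨ solve 4 (λ e b t x → (e :- con 1ℚ) :* (b :- t) := b :* e :- (t :* e :+ b :* (x :* e)) :- b :+ t :+ x :* e :* b)
           (λ _ → refl) eᵗ β (θ β) X ⟩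
    β ⊛ eᵗ ⊕ ⊖ (θ β ⊛ eᵗ ⊕ β ⊛ (X ⊛ eᵗ)) ⊕ ⊖ β ⊕ θ β ⊕ X ⊛ eᵗ ⊛ β
      ≈⟨ +-congʳ (+-congʳ (+-congʳ (+-cong β⊛eᵗ≗β+X (-‿cong θβ⊛eᵗ+β⊛[X⊛eᵗ]≗θβ+X)))) ⟩
    β ⊕ X ⊕ ⊖ (θ β ⊕ X) ⊕ ⊖ β ⊕ θ β ⊕ X ⊛ eᵗ ⊛ β
      ≈⟨ solve 4 (λ e b t x → b :+ x :- (t :+ x) :- b :+ t :+ x :* e :* b := x :* e :* b) (λ _ → refl) eᵗ β (θ β) X ⟩
    X ⊛ eᵗ ⊛ β ∎

  X⊛[X⊛α]≗e⁻ᵗ⊛[eᵗ-1]² : X ⊛ (X ⊛ α) ≗ e⁻ᵗ ⊛ ((eᵗ ⊕ ⊖ 𝟙) ⊛ (eᵗ ⊕ ⊖ 𝟙))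
  X⊛[X⊛α]≗e⁻ᵗ⊛[eᵗ-1]² = begin
    X ⊛ (X ⊛ α)
      ≈⟨ solve 1 (λ y → y := y :+ (con 1ℚ :+ con 1ℚ) :- (con 1ℚ :+ con 1ℚ)) (λ _ → refl) (X ⊛ (X ⊛ α)) ⟩
    X ⊛ (X ⊛ α) ⊕ (𝟙 ⊕ 𝟙) ⊕ ⊖ (𝟙 ⊕ 𝟙)
      ≈⟨ +-congʳ X⊛[X⊛α]+2≗eᵗ+e⁻ᵗ ⟩
    eᵗ ⊕ e⁻ᵗ ⊕ ⊖ (𝟙 ⊕ 𝟙)
      ≈⟨ solve 2 (λ e ē → e :+ ē :- (con 1ℚ :+ con 1ℚ) := con 1ℚ :* e :- (con 1ℚ :+ con 1ℚ) :* con 1ℚ :+ ē) (λ _ → refl) eᵗ e⁻ᵗ ⟩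
    𝟙 ⊛ eᵗ ⊕ ⊖ ((𝟙 ⊕ 𝟙) ⊛ 𝟙) ⊕ e⁻ᵗ
      ≈⟨ +-congʳ (+-cong (*-congʳ {eᵗ} eᵗ⊛e⁻ᵗ≗𝟙) (-‿cong (*-congˡ {𝟙 ⊕ 𝟙} eᵗ⊛e⁻ᵗ≗𝟙))) ⟨
    eᵗ ⊛ e⁻ᵗ ⊛ eᵗ ⊕ ⊖ ((𝟙 ⊕ 𝟙) ⊛ (eᵗ ⊛ e⁻ᵗ)) ⊕ e⁻ᵗ
      ≈⟨ solve 2 (λ e ē → e :* ē :* e :- (con 1ℚ :+ con 1ℚ) :* (e :* ē) :+ ē := ē :* ((e :- con 1ℚ) :* (e :- con 1ℚ))) (λ _ → refl) eᵗ e⁻ᵗ ⟩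
    e⁻ᵗ ⊛ ((eᵗ ⊕ ⊖ 𝟙) ⊛ (eᵗ ⊕ ⊖ 𝟙)) ∎

  α⊛[β-θβ]≗𝟙 : α ⊛ (β ⊕ ⊖ θ β) ≗ 𝟙
  α⊛[β-θβ]≗𝟙 = X-⊛-cancelˡ (X-⊛-cancelˡ (begin
    X ⊛ (X ⊛ (α ⊛ c))     ≈⟨ solve 3 (λ x a c → x :* (x :* (a :* c)) := x :* (x :* a) :* c) (λ _ → refl) X α c ⟩
    X ⊛ (X ⊛ α) ⊛ c       ≈⟨ *-congʳ {c} X⊛[X⊛α]≗e⁻ᵗ⊛[eᵗ-1]² ⟩
    e⁻ᵗ ⊛ (p ⊛ p) ⊛ c     ≈⟨ solve 3 (λ ē p c → ē :* (p :* p) :* c := ē :* p :* (p :* c)) (λ _ → refl) e⁻ᵗ p c ⟩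
    e⁻ᵗ ⊛ p ⊛ (p ⊛ c)     ≈⟨ *-congˡ {e⁻ᵗ ⊛ p} [eᵗ-1]⊛[β-θβ]≗X⊛eᵗ⊛β ⟩
    e⁻ᵗ ⊛ p ⊛ (X ⊛ eᵗ ⊛ β) ≈⟨ solve 5 (λ ē p x e b → ē :* p :* (x :* e :* b) := x :* (e :* ē) :* (p :* b)) (λ _ → refl) e⁻ᵗ p X eᵗ β ⟩
    X ⊛ (eᵗ ⊛ e⁻ᵗ) ⊛ (p ⊛ β) ≈⟨ *-cong (*-congˡ {X} eᵗ⊛e⁻ᵗ≗𝟙) [eᵗ-1]⊛β≗X ⟩
    X ⊛ 𝟙 ⊛ X             ≈⟨ solve 1 (λ x → x :* con 1ℚ :* x := x :* (x :* con 1ℚ)) (λ _ → refl) X ⟩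
    X ⊛ (X ⊛ 𝟙)           ∎))
    where
    p c : Series
    p = eᵗ ⊕ ⊖ 𝟙
    c = β ⊕ ⊖ θ β

  ε≗β-θβ : ε ≗ β ⊕ ⊖ θ β
  ε≗β-θβ = begin
    ε                        ≈⟨ ⊛-identityʳ ε ⟨
    ε ⊛ 𝟙                    ≈⟨ *-congˡ {ε} α⊛[β-θβ]≗𝟙 ⟨
    ε ⊛ (α ⊛ (β ⊕ ⊖ θ β))    ≈⟨ ⊛-assoc ε α (β ⊕ ⊖ θ β) ⟨
    ε ⊛ α ⊛ (β ⊕ ⊖ θ β)      ≈⟨ *-congʳ {β ⊕ ⊖ θ β} ε⊛α≗𝟙 ⟩
    𝟙 ⊛ (β ⊕ ⊖ θ β)          ≈⟨ ⊛-identityˡ (β ⊕ ⊖ θ β) ⟩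
    β ⊕ ⊖ θ β                ∎

E₁≡B-n*B : ∀ n → E₁ n ≡ B n - ℕ→ℚ n * B n
E₁≡B-n*B = egf-injective (λ n → trans (ε≗β-θβ n)
  (solve 3 (λ b u m → b :* u :- m :* (b :* u) := (b :- m :* b) :* u) refl (B n) (1/ n !) (ℕ→ℚ n)))
  where open +-*-Solver

theorem2 : (n : ℕ) → 1 ≤ n → E₁ n ≡ - (ℕ→ℚ (n ∸ 1) * B n)
theorem2 (suc m) _ = begin
  E₁ (suc m)                              ≡⟨ E₁≡B-n*B (suc m) ⟩
  B (suc m) - ℕ→ℚ (1 ℕ.+ m) * B (suc m)   ≡⟨ cong (λ x → B (suc m) - x * B (suc m)) (ℕ→ℚ-+ 1 m) ⟩
  B (suc m) - (1ℚ + ℕ→ℚ m) * B (suc m)    ≡⟨ solve 2 (λ b m → b :- (con 1ℚ :+ m) :* b := :- (m :* b)) refl (B (suc m)) (ℕ→ℚ m) ⟩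
  - (ℕ→ℚ m * B (suc m))                   ∎
  where
  open ≡-Reasoning
  open +-*-Solver
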